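{- Let $j$ be a non-negative integer. For every positive integer $n$, $\overline{p}_{3,j+1}(n)$ equals the number of partitions of $n$ with rank $\geq j$.
   Context: A partition of $n$ is a finite multiset of positive integers summing to $n$. The rank of a partition is its largest part minus its number of parts. For positive integers $A,a$ and a partition $\pi$, $\mathrm{mex}_{A,a}(\pi)$ is the smallest element of $\{a,a+A,a+2A,\dots\}$ that is not a part of $\pi$. $\overline{p}_{A,a}(n)$ is the number of partitions $\pi$ of $n$ with $\mathrm{mex}_{A,a}(\pi)\equiv A+a \pmod{2A}$. -}

module Defs where

open import Data.Nat using (ℕ; zero; suc; _+_; _*_; _∸_; _≤_; _<_; _≤?_; _≟_; NonZero)
open import Data.Nat.DivMod using (_%_)
open import Data.List using (List; []; _∷_; length; filter; concatMap; map; sum; upTo)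
open import Data.List.Membership.DecPropositional _≟_ using (_∈?_)
open import Data.Integer as ℤ using (ℤ)
open import Relation.Nullary using (Dec; yes; no; ¬?)
open import Relation.Nullary.Decidable using (⌊_⌋)
open import Data.Bool using (Bool; true; false; if_then_else_)

-- A partition is represented by the list of its parts in non-increasing order
-- (a canonical representative of the multiset).

-- pm f m n : all partitions of n with every part ≤ m, as non-increasing
-- lists of positive integers, each listed exactly once; f is recursion
-- fuel (f ≥ n suffices, as each step removes a positive part).
pm : ℕ → ℕ → ℕ → List (List ℕ)
pm _       _ zero    = [] ∷ []
pm zero    _ (suc _) = []
pm (suc f) m (suc n) =
  concatMap (λ k → map (k ∷_) (pm f k (suc n ∸ k)))
            (filter (λ k → k ≤? suc n) (filter (λ k → k ≤? m) (upTo (suc (suc n)) ∖0)))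
  where
    _∖0 : List ℕ → List ℕ
    [] ∖0 = []
    (zero ∷ xs) ∖0 = xs ∖0
    (suc x ∷ xs) ∖0 = suc x ∷ (xs ∖0)

partitions : ℕ → List (List ℕ)
partitions n = pm n n n

largestPart : List ℕ → ℕ
largestPart [] = 0
largestPart (x ∷ _) = x

rank : List ℕ → ℤ
rank π = ℤ.+ largestPart π ℤ.- ℤ.+ length π

-- mex_{A,a}(π): smallest element of {a, a+A, a+2A, ...} not a part of π.
-- Searching a + k*A for k = 0,1,...; fuel (length π + 1) suffices since π has
-- at most length π distinct parts.
mexFrom : ℕ → ℕ → ℕ → List ℕ → ℕ
mexFrom zero    A b π = b
mexFrom (suc f) A b π with b ∈? π
... | yes _ = mexFrom f A (b + A) π
... | no  _ = b

mex : ℕ → ℕ → List ℕ → ℕ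
mex A a π = mexFrom (suc (length π)) A a π

pbar : (A a : ℕ) → .{{NonZero A}} → ℕ → ℕ
pbar (suc A') a n =
  length (filter (λ π → mex A a π % (2 * A) ≟ (A + a) % (2 * A)) (partitions n))
  where A = suc A'

rankAtLeast : ℕ → ℕ → ℕ
rankAtLeast j n = length (filter (λ π → ℤ.+ j ℤ.≤? rank π) (partitions n))

-- Both sides F(j, n) satisfy F(j, j + 1 + n) + F(j + 3, n) = p(n) and vanish for n ≤ j
-- (except for the empty partition, of rank 0), so they agree by strong induction on n.
--
-- mex side, for any modulus A: a partition with mex_{A,b} ≡ b + A (mod 2A) must contain b,
-- and deleting b turns mex_{A,b} into mex_{A,b+A} of the rest.  That value lies in b + Aℕ,
-- so it is ≡ b + A exactly when it is not ≡ b + 2A ≡ b (mod 2A).  Hence deleting b is a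
-- bijection onto the partitions of n not counted by p̄_{A,b+A}.
--
-- rank side: deleting the largest part λ₁ of a partition of j + 1 + n of rank ≥ j and adding
-- a column of length λ₁ − j − 1 (one more box in each of the first λ₁ − j − 1 rows) gives a
-- partition of n of rank < j + 3, and this is a bijection.

module Submission where

open import Defs
open import Data.Nat
open import Data.Nat.Properties
open import Data.Nat.DivMod
open import Data.Nat.Induction using (<-rec)
open import Data.Nat.Tactic.RingSolver using (solve)
import Data.Integer as ℤ
import Data.Integer.Properties as ℤ
open import Algebra.Properties.CommutativeSemigroup +-commutativeSemigroup using (x∙yz≈y∙xz)
open import Data.List using (List; []; _∷_; _++_; length; map; filter; concatMap; upTo; applyUpTo)
open import Data.List.Properties using (length-++-sucʳ; filter-none; ∷-injectiveʳ)
open import Data.List.Membership.DecPropositional _≟_ using (_∈?_)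
open import Data.List.Membership.Propositional using (_∈_; find; lose)
open import Data.List.Membership.Propositional.Properties
  using (∈-∃++; ∈-++⁻; ∈-++⁺ˡ; ∈-++⁺ʳ; ∈-filter⁻; ∈-filter⁺; ∈-concatMap⁻; ∈-concatMap⁺; ∈-map⁻; ∈-map⁺; ∈-upTo⁺)
open import Data.List.Relation.Unary.Any using (here; there)
open import Data.List.Relation.Unary.All as All using (lookup)
import Data.List.Relation.Unary.All.Properties as All
import Data.List.Relation.Unary.AllPairs as AllPairs
import Data.List.Relation.Unary.AllPairs.Properties as AllPairs
open import Data.List.Relation.Unary.Unique.Propositional using (Unique; []; _∷_)
import Data.List.Relation.Unary.Unique.Propositional.Properties as Unique
open import Data.Product using (_,_; _×_; proj₁; proj₂; ∃-syntax)
open import Data.Sum using (_⊎_; inj₁; inj₂)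
import Data.Sum as Sum
open import Function using (_∘_; _⇔_; mk⇔; Equivalence)
open import Level using (0ℓ)
open import Relation.Nullary using (¬_; yes; no; contradiction)
open import Relation.Unary using (Pred; Decidable)
open import Relation.Unary.Properties using (∁?)
open import Relation.Binary.PropositionalEquality

private variable
  X Y : Set
  P : Pred X 0ℓ
  Q : Pred Y 0ℓ

length-≤-of-leftInverse : ∀ {xs : List X} {ys : List Y} (f : X → Y) (g : Y → X) → Unique xs →
                          (∀ {x} → x ∈ xs → f x ∈ ys × g (f x) ≡ x) → length xs ≤ length ys
length-≤-of-leftInverse {xs = []}     f g _            _  = z≤n
length-≤-of-leftInverse {xs = x ∷ xs} f g (x∉xs ∷ xs!) fg
  with fx∈ys , gfx≡x ← fg (here refl)
  with ys₁ , ys₂ , refl ← ∈-∃++ fx∈ys = begin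
    suc (length xs)             ≤⟨ s≤s (length-≤-of-leftInverse f g xs! fg′) ⟩
    suc (length (ys₁ ++ ys₂))   ≡⟨ length-++-sucʳ ys₁ (f x) ys₂ ⟨
    length (ys₁ ++ f x ∷ ys₂)   ∎
  where
  open ≤-Reasoning
  remove : ∀ {y} → y ∈ ys₁ ++ f x ∷ ys₂ → y ≢ f x → y ∈ ys₁ ++ ys₂
  remove y∈ y≢fx with ∈-++⁻ ys₁ y∈
  ... | inj₁ y∈ys₁         = ∈-++⁺ˡ y∈ys₁
  ... | inj₂ (here y≡fx)   = contradiction y≡fx y≢fx
  ... | inj₂ (there y∈ys₂) = ∈-++⁺ʳ ys₁ y∈ys₂
  fg′ : ∀ {x′} → x′ ∈ xs → f x′ ∈ ys₁ ++ ys₂ × g (f x′) ≡ x′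
  fg′ x′∈xs with fx′∈ , gfx′≡x′ ← fg (there x′∈xs) =
    remove fx′∈ (λ fx′≡fx → lookup x∉xs x′∈xs (trans (sym gfx≡x) (trans (cong g (sym fx′≡fx)) gfx′≡x′))) , gfx′≡x′

filter-leftInverse : (P? : Decidable P) (Q? : Decidable Q) {xs : List X} {ys : List Y} {f : X → Y} {g : Y → X} →
                     (∀ {x} → x ∈ xs → P x → f x ∈ ys × Q (f x) × g (f x) ≡ x) →
                     ∀ {x} → x ∈ filter P? xs → f x ∈ filter Q? ys × g (f x) ≡ x
filter-leftInverse P? Q? {xs} fg x∈ with x∈xs , Px ← ∈-filter⁻ P? {xs = xs} x∈
  with fx∈ys , Qfx , gfx≡x ← fg x∈xs Px = ∈-filter⁺ Q? fx∈ys Qfx , gfx≡x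

length-filter-≡-of-inverse : (P? : Decidable P) (Q? : Decidable Q) {xs : List X} {ys : List Y} →
                             Unique xs → Unique ys → (f : X → Y) (g : Y → X) →
                             (∀ {x} → x ∈ xs → P x → f x ∈ ys × Q (f x) × g (f x) ≡ x) →
                             (∀ {y} → y ∈ ys → Q y → g y ∈ xs × P (g y) × f (g y) ≡ y) →
                             length (filter P? xs) ≡ length (filter Q? ys)
length-filter-≡-of-inverse P? Q? xs! ys! f g fg gf = ≤-antisym
  (length-≤-of-leftInverse f g (Unique.filter⁺ P? xs!) (filter-leftInverse P? Q? {f = f} {g} fg))
  (length-≤-of-leftInverse g f (Unique.filter⁺ Q? ys!) (filter-leftInverse Q? P? {f = g} {f} gf))

length-filter-∁+length-filter : (P? : Decidable P) (xs : List X) →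
                                length (filter (∁? P?) xs) + length (filter P? xs) ≡ length xs
length-filter-∁+length-filter P? [] = refl
length-filter-∁+length-filter P? (x ∷ xs) with P? x
... | yes _ = trans (+-suc _ _) (cong suc (length-filter-∁+length-filter P? xs))
... | no  _ = cong suc (length-filter-∁+length-filter P? xs)

length-filter-none : (P? : Decidable P) (xs : List X) →
                     (∀ {x} → x ∈ xs → ¬ P x) → length (filter P? xs) ≡ 0
length-filter-none P? xs ¬P = cong length (filter-none P? (All.tabulate ¬P))

concatMap-Unique : (label : Y → X) (G : X → List Y) {ks : List X} → Unique ks →
                   (∀ k → Unique (G k)) → (∀ k {v} → v ∈ G k → label v ≡ k) →
                   Unique (concatMap G ks)
concatMap-Unique label G ks! G! labelG = Unique.concat⁺
  (All.map⁺ (All.tabulate λ {k} _ → G! k))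
  (AllPairs.map⁺ (AllPairs.map (λ k≢k′ {_} (v∈Gk , v∈Gk′) → k≢k′ (trans (sym (labelG _ v∈Gk)) (labelG _ v∈Gk′))) ks!))

data IsPartition : (bound size : ℕ) → List ℕ → Set where
  []   : ∀ {m} → IsPartition m 0 []
  cons : ∀ {m n k π} → 1 ≤ k → k ≤ m → IsPartition k n π → IsPartition m (k + n) (k ∷ π)

IsPartition-mono : ∀ {m m′ n π} → m ≤ m′ → IsPartition m n π → IsPartition m′ n π
IsPartition-mono _    []              = []
IsPartition-mono m≤m′ (cons 1≤k k≤m p) = cons 1≤k (≤-trans k≤m m≤m′) p

IsPartition-size : ∀ {m n π} → IsPartition m n π → IsPartition n n π
IsPartition-size []                        = []
IsPartition-size (cons {n = n} {k} 1≤k _ p) = cons 1≤k (m≤m+n k n) p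

IsPartition-largestPart : ∀ {m n π} → IsPartition m n π → IsPartition (largestPart π) n π
IsPartition-largestPart []             = []
IsPartition-largestPart (cons 1≤k _ p) = cons 1≤k ≤-refl p

largestPart-≤ : ∀ {m n π} → IsPartition m n π → largestPart π ≤ m
largestPart-≤ []             = z≤n
largestPart-≤ (cons _ k≤m _) = k≤m

∈-IsPartition : ∀ {m n π x} → IsPartition m n π → x ∈ π → 1 ≤ x × x ≤ m
∈-IsPartition (cons 1≤k k≤m _) (here refl) = 1≤k , k≤m
∈-IsPartition (cons _   k≤m p) (there x∈π) = proj₁ (∈-IsPartition p x∈π) , ≤-trans (proj₂ (∈-IsPartition p x∈π)) k≤m

∷-IsPartition⁻ : ∀ {m s x xs} → IsPartition m s (x ∷ xs) → ∃[ s′ ] s ≡ x + s′ × x ≤ m × IsPartition x s′ xs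
∷-IsPartition⁻ (cons _ x≤m p) = _ , refl , x≤m , p

firstPartChoices : ℕ → ℕ → List ℕ
firstPartChoices m n = filter (λ k → k ≤? suc n) (filter (λ k → k ≤? m) (filter (1 ≤?_) (upTo (2 + n))))

-- Defs drops the zeros of upTo (2 + n) with a where-bound function that cannot be named;
-- dropZeros is that function, found by unification (the with makes the problem a pattern).
pm-suc : ∀ f m n → pm (suc f) m (suc n) ≡ concatMap (λ k → map (k ∷_) (pm f k (suc n ∸ k))) (firstPartChoices m n)
pm-suc f m n = trans unfold (cong (λ ks → body (1 ∷ ks)) (dropZeros≗filter (applyUpTo (λ x → 2+ x) n)))
  where
  body : List ℕ → List (List ℕ)
  body ks = concatMap (λ k → map (k ∷_) (pm f k (suc n ∸ k))) (filter (λ k → k ≤? suc n) (filter (λ k → k ≤? m) ks))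
  dropZeros : List ℕ → List ℕ
  dropZeros = _
  unfold : pm (suc f) m (suc n) ≡ body (1 ∷ dropZeros (applyUpTo (λ x → 2+ x) n))
  unfold with applyUpTo (λ x → 2+ x) n
  ... | ks = refl
  dropZeros≗filter : ∀ ks → dropZeros ks ≡ filter (1 ≤?_) ks
  dropZeros≗filter []           = refl
  dropZeros≗filter (zero ∷ ks)  = dropZeros≗filter ks
  dropZeros≗filter (suc k ∷ ks) = cong (suc k ∷_) (dropZeros≗filter ks)

module _ {m n k : ℕ} where

  ∈-firstPartChoices⁻ : k ∈ firstPartChoices m n → 1 ≤ k × k ≤ m × k ≤ suc n
  ∈-firstPartChoices⁻ k∈ =
    let k∈₁ , k≤1+n = ∈-filter⁻ (λ k → k ≤? suc n) {xs = filter (λ k → k ≤? m) (filter (1 ≤?_) (upTo (2 + n)))} k∈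
        k∈₂ , k≤m   = ∈-filter⁻ (λ k → k ≤? m) {xs = filter (1 ≤?_) (upTo (2 + n))} k∈₁
        _   , 1≤k   = ∈-filter⁻ (1 ≤?_) {xs = upTo (2 + n)} k∈₂
    in 1≤k , k≤m , k≤1+n

  ∈-firstPartChoices⁺ : 1 ≤ k → k ≤ m → k ≤ suc n → k ∈ firstPartChoices m n
  ∈-firstPartChoices⁺ 1≤k k≤m k≤1+n =
    ∈-filter⁺ (λ k → k ≤? suc n) (∈-filter⁺ (λ k → k ≤? m) (∈-filter⁺ (1 ≤?_) (∈-upTo⁺ (s≤s k≤1+n)) 1≤k) k≤m) k≤1+n

firstPartChoices-Unique : ∀ m n → Unique (firstPartChoices m n)
firstPartChoices-Unique m n =
  Unique.filter⁺ (λ k → k ≤? suc n) (Unique.filter⁺ (λ k → k ≤? m) (Unique.filter⁺ (1 ≤?_) (Unique.upTo⁺ (2 + n))))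

∈-pm⁻ : ∀ f m n {π} → π ∈ pm f m n → IsPartition m n π
∈-pm⁻ f       m zero    (here refl) = []
∈-pm⁻ (suc f) m (suc n) π∈ rewrite pm-suc f m n
  with k , k∈ , π∈′ ← find (∈-concatMap⁻ _ {xs = firstPartChoices m n} π∈)
  with σ , σ∈ , refl ← ∈-map⁻ (k ∷_) π∈′
  with 1≤k , k≤m , k≤1+n ← ∈-firstPartChoices⁻ k∈ =
    subst (λ s → IsPartition m s (k ∷ σ)) (m+[n∸m]≡n k≤1+n) (cons 1≤k k≤m (∈-pm⁻ f k (suc n ∸ k) σ∈))

∈-pm⁺ : ∀ f m n {π} → IsPartition m n π → n ≤ f → π ∈ pm f m n
∈-pm⁺ f m _ [] _ = here refl
∈-pm⁺ (suc f) m _ (cons {n = n} {k = suc k} {π = σ} 1≤k k≤m p) (s≤s k+n≤f) rewrite pm-suc f m (k + n) =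
  ∈-concatMap⁺ _ {xs = firstPartChoices m (k + n)} (lose k∈ (∈-map⁺ (suc k ∷_) σ∈))
  where
  k∈ : suc k ∈ firstPartChoices m (k + n)
  k∈ = ∈-firstPartChoices⁺ 1≤k k≤m (s≤s (m≤m+n k n))
  σ∈ : σ ∈ pm f (suc k) (k + n ∸ k)
  σ∈ = subst (λ s → σ ∈ pm f (suc k) s) (sym (m+n∸m≡n k n)) (∈-pm⁺ f (suc k) n p (≤-trans (m≤n+m n k) k+n≤f))

pm-Unique : ∀ f m n → Unique (pm f m n)
pm-Unique f       m zero    = All.[] ∷ []
pm-Unique zero    m (suc n) = []
pm-Unique (suc f) m (suc n) rewrite pm-suc f m n =
  concatMap-Unique largestPart G (firstPartChoices-Unique m n) (λ k → Unique.map⁺ ∷-injectiveʳ (pm-Unique f k (suc n ∸ k))) largestPart-G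
  where
  G : ℕ → List (List ℕ)
  G k = map (k ∷_) (pm f k (suc n ∸ k))
  largestPart-G : ∀ k {π} → π ∈ G k → largestPart π ≡ k
  largestPart-G k π∈ with _ , _ , refl ← ∈-map⁻ (k ∷_) π∈ = refl

∈-partitions⁻ : ∀ {n π} → π ∈ partitions n → IsPartition n n π
∈-partitions⁻ {n} = ∈-pm⁻ n n n

∈-partitions⁺ : ∀ {m n π} → IsPartition m n π → π ∈ partitions n
∈-partitions⁺ {n = n} p = ∈-pm⁺ n n n (IsPartition-size p) ≤-refl

partitions-Unique : ∀ n → Unique (partitions n)
partitions-Unique n = pm-Unique n n n

insert : ℕ → List ℕ → List ℕ
insert b [] = b ∷ []
insert b (x ∷ xs) with x ≤? b
... | yes _ = b ∷ x ∷ xs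
... | no  _ = x ∷ insert b xs

delete : ℕ → List ℕ → List ℕ
delete b [] = []
delete b (x ∷ xs) with x ≟ b
... | yes _ = xs
... | no  _ = x ∷ delete b xs

insert-IsPartition : ∀ {m n σ} b m′ → 1 ≤ b → b ≤ m′ → m ≤ m′ → IsPartition m n σ → IsPartition m′ (b + n) (insert b σ)
insert-IsPartition b m′ 1≤b b≤m′ m≤m′ [] = cons 1≤b b≤m′ []
insert-IsPartition b m′ 1≤b b≤m′ m≤m′ (cons {n = n} {k = x} {π = xs} 1≤x x≤m p) with x ≤? b
... | yes x≤b = cons 1≤b b≤m′ (cons 1≤x x≤b p)
... | no  x≰b = subst (λ s → IsPartition m′ s (x ∷ insert b xs)) (x∙yz≈y∙xz x b n)
                  (cons 1≤x (≤-trans x≤m m≤m′) (insert-IsPartition b x 1≤b (<⇒≤ (≰⇒> x≰b)) ≤-refl p))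

delete-IsPartition : ∀ {m n π} b → IsPartition m n π → b ∈ π → ∃[ n′ ] n ≡ b + n′ × IsPartition m n′ (delete b π)
delete-IsPartition b (cons {n = n} {k = x} 1≤x x≤m p) b∈ with x ≟ b
... | yes refl = n , refl , IsPartition-mono x≤m p
delete-IsPartition b (cons 1≤x x≤m p) (here b≡x)   | no x≢b = contradiction (sym b≡x) x≢b
delete-IsPartition b (cons {k = x} 1≤x x≤m p) (there b∈) | no x≢b
  with n′ , refl , p′ ← delete-IsPartition b p b∈ = x + n′ , x∙yz≈y∙xz x b n′ , cons 1≤x x≤m p′

delete-insert : ∀ b σ → delete b (insert b σ) ≡ σ
delete-insert b [] with b ≟ b
... | yes _   = refl
... | no  b≢b = contradiction refl b≢b
delete-insert b (x ∷ xs) with x ≤? b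
... | yes _ with b ≟ b
...   | yes _   = refl
...   | no  b≢b = contradiction refl b≢b
delete-insert b (x ∷ xs) | no x≰b with x ≟ b
...   | yes refl = contradiction ≤-refl x≰b
...   | no  _    = cong (x ∷_) (delete-insert b xs)

insert-delete : ∀ {m n π} b → IsPartition m n π → b ∈ π → insert b (delete b π) ≡ π
insert-delete b (cons {k = x} _ _ p) b∈ with x ≟ b
insert-delete b (cons {π = []}     _ _ p) b∈ | yes refl = refl
insert-delete b (cons {π = y ∷ ys} _ _ p) b∈ | yes refl with y ≤? b
... | yes _   = refl
... | no  y≰b = contradiction (largestPart-≤ p) y≰b
insert-delete b (cons _ _ p) (here b≡x)  | no x≢b = contradiction (sym b≡x) x≢b
insert-delete b (cons {k = x} _ _ p) (there b∈) | no x≢b with x ≤? b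
... | yes x≤b = contradiction (≤-antisym x≤b (proj₂ (∈-IsPartition p b∈))) x≢b
... | no  _   = cong (x ∷_) (insert-delete b p b∈)

∈-insert : ∀ b σ → b ∈ insert b σ
∈-insert b [] = here refl
∈-insert b (y ∷ ys) with y ≤? b
... | yes _ = here refl
... | no  _ = there (∈-insert b ys)

∈-insert⁺ : ∀ {x} b σ → x ∈ σ → x ∈ insert b σ
∈-insert⁺ b (y ∷ ys) x∈ with y ≤? b
... | yes _ = there x∈
∈-insert⁺ b (y ∷ ys) (here refl) | no _ = here refl
∈-insert⁺ b (y ∷ ys) (there x∈)  | no _ = there (∈-insert⁺ b ys x∈)

∈-insert⁻ : ∀ {x} b σ → x ∈ insert b σ → x ≡ b ⊎ x ∈ σ
∈-insert⁻ b [] (here x≡b) = inj₁ x≡b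
∈-insert⁻ b (y ∷ ys) x∈ with y ≤? b
∈-insert⁻ b (y ∷ ys) (here x≡b)  | yes _ = inj₁ x≡b
∈-insert⁻ b (y ∷ ys) (there x∈)  | yes _ = inj₂ x∈
∈-insert⁻ b (y ∷ ys) (here x≡y)  | no  _ = inj₂ (here x≡y)
∈-insert⁻ b (y ∷ ys) (there x∈)  | no  _ = Sum.map₂ there (∈-insert⁻ b ys x∈)

length-insert : ∀ b σ → length (insert b σ) ≡ suc (length σ)
length-insert b [] = refl
length-insert b (y ∷ ys) with y ≤? b
... | yes _ = refl
... | no  _ = cong suc (length-insert b ys)

module _ (A : ℕ) .{{_ : NonZero A}} where

  private instance
    2A-nonZero : NonZero (2 * A)
    2A-nonZero = m*n≢0 2 A

  A<2A : A < 2 * A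
  A<2A = subst (A <_) (cong (A +_) (sym (+-identityʳ A))) (m<m+n A (>-nonZero⁻¹ A))

  [m+n]%[2n]≢m : ∀ r → (r + A) % (2 * A) ≢ r
  [m+n]%[2n]≢m r eq =
    A≢k*2A ((r + A) / (2 * A)) (+-cancelˡ-≡ r A _ (trans (m≡m%n+[m/n]*n (r + A) (2 * A)) (cong (_+ (r + A) / (2 * A) * (2 * A)) eq)))
    where
    A≢k*2A : ∀ k → A ≢ k * (2 * A)
    A≢k*2A zero    = ≢-nonZero⁻¹ A
    A≢k*2A (suc k) A≡ = <⇒≱ A<2A (subst (2 * A ≤_) (sym A≡) (m≤m+n (2 * A) (k * (2 * A))))

  m%[2n]≢[m+n]%[2n] : ∀ b → b % (2 * A) ≢ (b + A) % (2 * A)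
  m%[2n]≢[m+n]%[2n] b eq = [m+n]%[2n]≢m (b % (2 * A)) (begin
    (b % (2 * A) + A) % (2 * A)               ≡⟨ cong (λ a → (b % (2 * A) + a) % (2 * A)) (m<n⇒m%n≡m A<2A) ⟨
    (b % (2 * A) + A % (2 * A)) % (2 * A)     ≡⟨ %-distribˡ-+ b A (2 * A) ⟨
    (b + A) % (2 * A)                         ≡⟨ eq ⟨
    b % (2 * A)                               ∎)
    where open ≡-Reasoning

  [m+n*i]%[2n] : ∀ b i → (b + A * i) % (2 * A) ≡ b % (2 * A) ⊎ (b + A * i) % (2 * A) ≡ (b + A) % (2 * A)
  [m+n*i]%[2n] b zero          = inj₁ (cong (_% (2 * A)) (trans (cong (b +_) (*-zeroʳ A)) (+-identityʳ b)))
  [m+n*i]%[2n] b (suc zero)    = inj₂ (cong (λ a → (b + a) % (2 * A)) (*-identityʳ A))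
  [m+n*i]%[2n] b (suc (suc i)) = Sum.map (trans shift) (trans shift) ([m+n*i]%[2n] b i)
    where
    open ≡-Reasoning
    shift : (b + A * (2 + i)) % (2 * A) ≡ (b + A * i) % (2 * A)
    shift = begin
      (b + A * (2 + i)) % (2 * A)      ≡⟨ cong (_% (2 * A)) (solve (b ∷ A ∷ i ∷ [])) ⟩
      (b + A * i + 2 * A) % (2 * A)    ≡⟨ [m+n]%n≡m%n (b + A * i) (2 * A) ⟩
      (b + A * i) % (2 * A)            ∎

  mexFrom-cong : ∀ f b {π π′} → (∀ {x} → b ≤ x → x ∈ π → x ∈ π′) → (∀ {x} → b ≤ x → x ∈ π′ → x ∈ π) →
                 mexFrom f A b π ≡ mexFrom f A b π′
  mexFrom-cong zero    b         π⊆π′ π′⊆π = refl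
  mexFrom-cong (suc f) b {π} {π′} π⊆π′ π′⊆π with b ∈? π | b ∈? π′
  ... | yes _   | yes _    = mexFrom-cong f (b + A) (π⊆π′ ∘ b+A≤⇒b≤) (π′⊆π ∘ b+A≤⇒b≤)
    where
    b+A≤⇒b≤ : ∀ {x} → b + A ≤ x → b ≤ x
    b+A≤⇒b≤ = ≤-trans (m≤m+n b A)
  ... | yes b∈π | no  b∉π′ = contradiction (π⊆π′ ≤-refl b∈π) b∉π′
  ... | no  b∉π | yes b∈π′ = contradiction (π′⊆π ≤-refl b∈π′) b∉π
  ... | no  _   | no  _    = refl

  mexFrom-progression : ∀ f b π → ∃[ i ] mexFrom f A b π ≡ b + A * i
  mexFrom-progression zero    b π = 0 , sym (trans (cong (b +_) (*-zeroʳ A)) (+-identityʳ b))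
  mexFrom-progression (suc f) b π with b ∈? π
  ... | no  _ = 0 , sym (trans (cong (b +_) (*-zeroʳ A)) (+-identityʳ b))
  ... | yes _ with i , eq ← mexFrom-progression f (b + A) π =
    suc i , trans eq (trans (+-assoc b A (A * i)) (cong (b +_) (sym (*-suc A i))))

  mex-insert : ∀ b σ → mex A b (insert b σ) ≡ mex A (b + A) σ
  mex-insert b σ rewrite length-insert b σ with b ∈? insert b σ
  ... | no  b∉ = contradiction (∈-insert b σ) b∉
  ... | yes _  = mexFrom-cong (suc (length σ)) (b + A) insert⊆σ (λ _ → ∈-insert⁺ b σ)
    where
    insert⊆σ : ∀ {x} → b + A ≤ x → x ∈ insert b σ → x ∈ σ
    insert⊆σ b+A≤x x∈ with ∈-insert⁻ b σ x∈
    ... | inj₁ refl = contradiction b+A≤x (<⇒≱ (m<m+n b (>-nonZero⁻¹ A)))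
    ... | inj₂ x∈σ  = x∈σ

  -- mex A b π is b + A * i for some i, and OddMex b π says that i is odd.
  OddMex : ℕ → List ℕ → Set
  OddMex b π = mex A b π % (2 * A) ≡ (A + b) % (2 * A)

  oddMex? : ∀ b → Decidable (OddMex b)
  oddMex? b π = mex A b π % (2 * A) ≟ (A + b) % (2 * A)

  OddMex⇒∈ : ∀ {b π} → OddMex b π → b ∈ π
  OddMex⇒∈ {b} {π} odd with b ∈? π
  ... | yes b∈ = b∈
  -- here mex A b π reduces to b
  ... | no  _  = contradiction (trans odd (cong (_% (2 * A)) (+-comm A b))) (m%[2n]≢[m+n]%[2n] b)

  OddMex-insert : ∀ b σ → OddMex b (insert b σ) ⇔ (¬ OddMex (b + A) σ)
  OddMex-insert b σ = mk⇔ to from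
    where
    m = mex A (b + A) σ
    m≡ : mex A b (insert b σ) % (2 * A) ≡ m % (2 * A)
    m≡ = cong (_% (2 * A)) (mex-insert b σ)
    A+[b+A]≡b : (A + (b + A)) % (2 * A) ≡ b % (2 * A)
    A+[b+A]≡b = trans (cong (_% (2 * A)) A+[b+A]≡b+2A) ([m+n]%n≡m%n b (2 * A))
      where
      A+[b+A]≡b+2A : A + (b + A) ≡ b + 2 * A
      A+[b+A]≡b+2A = solve (A ∷ b ∷ [])
    to : OddMex b (insert b σ) → ¬ OddMex (b + A) σ
    to odd odd′ = m%[2n]≢[m+n]%[2n] b (begin
      b % (2 * A)                      ≡⟨ A+[b+A]≡b ⟨
      (A + (b + A)) % (2 * A)          ≡⟨ odd′ ⟨
      m % (2 * A)                      ≡⟨ m≡ ⟨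
      mex A b (insert b σ) % (2 * A)   ≡⟨ odd ⟩
      (A + b) % (2 * A)                ≡⟨ cong (_% (2 * A)) (+-comm A b) ⟩
      (b + A) % (2 * A)                ∎)
      where open ≡-Reasoning
    from : ¬ OddMex (b + A) σ → OddMex b (insert b σ)
    from even with i , mex≡ ← mexFrom-progression (suc (length σ)) (b + A) σ
      with [m+n*i]%[2n] (b + A) i
    ... | inj₁ ≡b+A = trans m≡ (trans (cong (_% (2 * A)) mex≡) (trans ≡b+A (cong (_% (2 * A)) (+-comm b A))))
    ... | inj₂ ≡b+A+A = contradiction (trans (cong (_% (2 * A)) mex≡) (trans ≡b+A+A (cong (_% (2 * A)) (+-comm (b + A) A)))) even

  oddMex-vanishes : ∀ {b n} → n < b → length (filter (oddMex? b) (partitions n)) ≡ 0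
  oddMex-vanishes {b} n<b = length-filter-none (oddMex? b) _ λ π∈ odd →
    <⇒≱ n<b (proj₂ (∈-IsPartition (∈-partitions⁻ π∈) (OddMex⇒∈ odd)))

  oddMex-shift : ∀ b n → 1 ≤ b →
                 length (filter (oddMex? b) (partitions (b + n))) ≡ length (filter (∁? (oddMex? (b + A))) (partitions n))
  oddMex-shift b n 1≤b = length-filter-≡-of-inverse (oddMex? b) (∁? (oddMex? (b + A)))
    (partitions-Unique (b + n)) (partitions-Unique n) (delete b) (insert b) remove-b add-b
    where
    remove-b : ∀ {π} → π ∈ partitions (b + n) → OddMex b π →
               delete b π ∈ partitions n × ¬ OddMex (b + A) (delete b π) × insert b (delete b π) ≡ π
    remove-b {π} π∈ odd with p ← ∈-partitions⁻ π∈ | b∈ ← OddMex⇒∈ odd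
      with n′ , b+n≡b+n′ , p′ ← delete-IsPartition b p b∈
      with refl ← +-cancelˡ-≡ b n n′ b+n≡b+n′ =
        ∈-partitions⁺ p′ , Equivalence.to (OddMex-insert b (delete b π)) (subst (OddMex b) (sym ins∘del) odd) , ins∘del
      where
      ins∘del = insert-delete b p b∈
    add-b : ∀ {σ} → σ ∈ partitions n → ¬ OddMex (b + A) σ →
            insert b σ ∈ partitions (b + n) × OddMex b (insert b σ) × delete b (insert b σ) ≡ σ
    add-b {σ} σ∈ even =
      ∈-partitions⁺ (insert-IsPartition b (b + n) 1≤b (m≤m+n b n) (m≤n+m n b) (∈-partitions⁻ σ∈)) ,
      Equivalence.from (OddMex-insert b σ) even ,
      delete-insert b σ

pbar-vanishes : ∀ A .{{_ : NonZero A}} {b n} → n < b → pbar A b n ≡ 0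
pbar-vanishes (suc A′) = oddMex-vanishes (suc A′)

pbar-recurrence : ∀ A .{{_ : NonZero A}} b n → pbar A (suc b) (suc b + n) + pbar A (suc b + A) n ≡ length (partitions n)
pbar-recurrence A@(suc _) b n = trans
  (cong (_+ pbar A (suc b + A) n) (oddMex-shift A (suc b) n (s≤s z≤n)))
  (length-filter-∁+length-filter (oddMex? A (suc b + A)) (partitions n))

RankAtLeast : ℕ → List ℕ → Set
RankAtLeast j π = ℤ.+ j ℤ.≤ rank π

rankAtLeast? : ∀ j → Decidable (RankAtLeast j)
rankAtLeast? j π = ℤ.+ j ℤ.≤? rank π

RankAtLeast⇔ : ∀ j π → RankAtLeast j π ⇔ (j + length π ≤ largestPart π)
RankAtLeast⇔ j π = mk⇔ to from
  where
  a = largestPart π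
  ℓ = length π
  rank≡ : ℓ ≤ a → rank π ≡ ℤ.+ (a ∸ ℓ)
  rank≡ ℓ≤a = trans (ℤ.m-n≡m⊖n a ℓ) (ℤ.⊖-≥ ℓ≤a)
  to : RankAtLeast j π → j + ℓ ≤ a
  to j≤rank = m≤o∸n⇒m+n≤o j ℓ≤a (ℤ.drop‿+≤+ (subst (ℤ.+ j ℤ.≤_) (rank≡ ℓ≤a) j≤rank))
    where
    ℓ≤a : ℓ ≤ a
    ℓ≤a = ℤ.drop‿+≤+ (ℤ.0≤i-j⇒j≤i (ℤ.≤-trans (ℤ.+≤+ z≤n) j≤rank))
  from : j + ℓ ≤ a → RankAtLeast j π
  from j+ℓ≤a = subst (ℤ.+ j ℤ.≤_) (sym (rank≡ (≤-trans (m≤n+m ℓ j) j+ℓ≤a))) (ℤ.+≤+ (m+n≤o⇒m≤o∸n j j+ℓ≤a))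

addColumn : ℕ → List ℕ → List ℕ
addColumn zero    xs       = xs
addColumn (suc c) []       = 1 ∷ addColumn c []
addColumn (suc c) (x ∷ xs) = suc x ∷ addColumn c xs

removeColumn : List ℕ → List ℕ
removeColumn []                 = []
removeColumn (zero ∷ xs)        = removeColumn xs
removeColumn (suc zero ∷ xs)    = removeColumn xs
removeColumn (suc (suc x) ∷ xs) = suc x ∷ removeColumn xs

addColumn-[]-IsPartition : ∀ c → IsPartition 1 c (addColumn c [])
addColumn-[]-IsPartition zero    = []
addColumn-[]-IsPartition (suc c) = cons ≤-refl ≤-refl (addColumn-[]-IsPartition c)

addColumn-IsPartition : ∀ {m s xs} c → length xs ≤ c → IsPartition m s xs → IsPartition (suc m) (s + c) (addColumn c xs)
addColumn-IsPartition c _ [] = IsPartition-mono (s≤s z≤n) (addColumn-[]-IsPartition c)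
addColumn-IsPartition {m} (suc c) (s≤s ℓ≤c) (cons {n = s} {k = x} {π = xs} 1≤x x≤m p) =
  subst (λ t → IsPartition (suc m) t (suc x ∷ addColumn c xs)) sizes
    (cons (s≤s z≤n) (s≤s x≤m) (addColumn-IsPartition c ℓ≤c p))
  where
  sizes : suc x + (s + c) ≡ x + s + suc c
  sizes = solve (x ∷ s ∷ c ∷ [])

length-addColumn : ∀ c xs → length xs ≤ c → length (addColumn c xs) ≡ c
length-addColumn zero    []       _         = refl
length-addColumn (suc c) []       _         = cong suc (length-addColumn c [] z≤n)
length-addColumn (suc c) (x ∷ xs) (s≤s ℓ≤c) = cong suc (length-addColumn c xs ℓ≤c)

largestPart-addColumn : ∀ c xs → largestPart (addColumn c xs) ≤ suc (largestPart xs)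
largestPart-addColumn zero    []       = z≤n
largestPart-addColumn zero    (x ∷ xs) = n≤1+n x
largestPart-addColumn (suc c) []       = ≤-refl
largestPart-addColumn (suc c) (x ∷ xs) = ≤-refl

removeColumn-addColumn-[] : ∀ c → removeColumn (addColumn c []) ≡ []
removeColumn-addColumn-[] zero    = refl
removeColumn-addColumn-[] (suc c) = removeColumn-addColumn-[] c

removeColumn-addColumn : ∀ {m s xs} c → length xs ≤ c → IsPartition m s xs → removeColumn (addColumn c xs) ≡ xs
removeColumn-addColumn c       _         []                       = removeColumn-addColumn-[] c
removeColumn-addColumn (suc c) (s≤s ℓ≤c) (cons {k = suc x} _ _ p) = cong (suc x ∷_) (removeColumn-addColumn c ℓ≤c p)

removeColumn-IsPartition : ∀ {m s σ} → IsPartition m s σ → ∃[ s′ ] s ≡ s′ + length σ × IsPartition (pred m) s′ (removeColumn σ)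
removeColumn-IsPartition [] = 0 , refl , []
removeColumn-IsPartition (cons {k = suc zero} _ _ p) with s′ , refl , q ← removeColumn-IsPartition p =
  s′ , sym (+-suc s′ _) , IsPartition-mono z≤n q
removeColumn-IsPartition (cons {k = suc (suc x)} {π = xs} _ x≤m p) with s′ , refl , q ← removeColumn-IsPartition p =
  suc x + s′ , sizes , cons (s≤s z≤n) (∸-monoˡ-≤ 1 x≤m) q
  where
  sizes : suc (suc x) + (s′ + length xs) ≡ suc x + s′ + suc (length xs)
  sizes = trans (cong (λ t → 2 + t) (sym (+-assoc x s′ (length xs)))) (sym (+-suc (suc x + s′) (length xs)))

length-removeColumn : ∀ σ → length (removeColumn σ) ≤ length σ
length-removeColumn []                 = z≤n
length-removeColumn (zero ∷ xs)        = m≤n⇒m≤1+n (length-removeColumn xs)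
length-removeColumn (suc zero ∷ xs)    = m≤n⇒m≤1+n (length-removeColumn xs)
length-removeColumn (suc (suc x) ∷ xs) = s≤s (length-removeColumn xs)

removeColumn-ones : ∀ {s xs} → IsPartition 1 s xs → removeColumn xs ≡ []
removeColumn-ones []                                 = refl
removeColumn-ones (cons {k = suc zero}    _ _ p)       = removeColumn-ones p
removeColumn-ones (cons {k = suc (suc _)} _ (s≤s ()) _)

addColumn-removeColumn : ∀ {m s σ} → IsPartition m s σ → addColumn (length σ) (removeColumn σ) ≡ σ
addColumn-removeColumn [] = refl
addColumn-removeColumn (cons {k = suc zero} {π = xs} _ _ p)
  with removeColumn xs | removeColumn-ones p | addColumn-removeColumn p
... | _ | refl | ih = cong (1 ∷_) ih
addColumn-removeColumn (cons {k = suc (suc x)} _ _ p) = cong (suc (suc x) ∷_) (addColumn-removeColumn p)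

+length≤largestPart⇒<size : ∀ {m n π} j → IsPartition m n π → j + length π ≤ largestPart π → 0 < j + n → j < n
+length≤largestPart⇒<size j []                         j+0≤0     0<j+0 = contradiction j+0≤0 (<⇒≱ 0<j+0)
+length≤largestPart⇒<size j (cons {n = s} {k} _ _ _) j+1+ℓ≤k _ = <-≤-trans (<-≤-trans (m<m+n j z<s) j+1+ℓ≤k) (m≤m+n k s)

largestPartToColumn : ℕ → List ℕ → List ℕ
largestPartToColumn j []       = []
largestPartToColumn j (x ∷ xs) = addColumn (x ∸ suc j) xs

columnToLargestPart : ℕ → List ℕ → List ℕ
columnToLargestPart j σ = (suc j + length σ) ∷ removeColumn σ

rankAtLeast-shift : ∀ j n → length (filter (rankAtLeast? j) (partitions (suc j + n))) ≡
                            length (filter (∁? (rankAtLeast? (j + 3))) (partitions n))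
rankAtLeast-shift j n = length-filter-≡-of-inverse (rankAtLeast? j) (∁? (rankAtLeast? (j + 3)))
  (partitions-Unique (suc j + n)) (partitions-Unique n) (largestPartToColumn j) (columnToLargestPart j) forward backward
  where
  forward : ∀ {π} → π ∈ partitions (suc j + n) → RankAtLeast j π →
            largestPartToColumn j π ∈ partitions n × ¬ RankAtLeast (j + 3) (largestPartToColumn j π) ×
            columnToLargestPart j (largestPartToColumn j π) ≡ π
  forward {[]} π∈ _ with () ← ∈-partitions⁻ {suc j + n} π∈
  forward {x ∷ xs} π∈ rank≥ with s , size≡ , _ , p ← ∷-IsPartition⁻ (∈-partitions⁻ π∈) = σ∈ , σ-rank , back
    where
    open ≤-Reasoning
    ℓ = length xs
    c = x ∸ suc j
    σ = addColumn c xs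
    j+1+ℓ≤x : suc j + ℓ ≤ x
    j+1+ℓ≤x = subst (_≤ x) (+-suc j ℓ) (Equivalence.to (RankAtLeast⇔ j (x ∷ xs)) rank≥)
    x≡ : suc j + c ≡ x
    x≡ = m+[n∸m]≡n (≤-trans (m≤m+n (suc j) ℓ) j+1+ℓ≤x)
    ℓ≤c : ℓ ≤ c
    ℓ≤c = +-cancelˡ-≤ (suc j) ℓ c (subst (suc j + ℓ ≤_) (sym x≡) j+1+ℓ≤x)
    length-σ : length σ ≡ c
    length-σ = length-addColumn c xs ℓ≤c
    s+c≡n : s + c ≡ n
    s+c≡n = +-cancelˡ-≡ (suc j) (s + c) n (begin-equality
      suc j + (s + c)  ≡⟨ cong (suc j +_) (+-comm s c) ⟩
      suc j + (c + s)  ≡⟨ +-assoc (suc j) c s ⟨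
      suc j + c + s    ≡⟨ cong (_+ s) x≡ ⟩
      x + s            ≡⟨ size≡ ⟨
      suc j + n        ∎)
    σ∈ : σ ∈ partitions n
    σ∈ = ∈-partitions⁺ (subst (λ t → IsPartition (suc x) t σ) s+c≡n (addColumn-IsPartition c ℓ≤c p))
    largestPart-σ< : largestPart σ < j + 3 + length σ
    largestPart-σ< = begin-strict
      largestPart σ          ≤⟨ largestPart-addColumn c xs ⟩
      suc (largestPart xs)   ≤⟨ s≤s (largestPart-≤ p) ⟩
      suc x                  ≡⟨ cong suc x≡ ⟨
      suc (suc j + c)        <⟨ n<1+n _ ⟩
      2 + (suc j + c)        ≡⟨ shift c ⟩
      j + 3 + c              ≡⟨ cong (j + 3 +_) length-σ ⟨
      j + 3 + length σ       ∎
      where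
      shift : ∀ c → 2 + (suc j + c) ≡ j + 3 + c
      shift c = solve (j ∷ c ∷ [])
    σ-rank : ¬ RankAtLeast (j + 3) σ
    σ-rank r = <⇒≱ largestPart-σ< (Equivalence.to (RankAtLeast⇔ (j + 3) σ) r)
    back : columnToLargestPart j σ ≡ x ∷ xs
    back = cong₂ _∷_ (trans (cong (suc j +_) length-σ) x≡) (removeColumn-addColumn c ℓ≤c p)
  backward : ∀ {σ} → σ ∈ partitions n → ¬ RankAtLeast (j + 3) σ →
             columnToLargestPart j σ ∈ partitions (suc j + n) × RankAtLeast j (columnToLargestPart j σ) ×
             largestPartToColumn j (columnToLargestPart j σ) ≡ σ
  backward {σ} σ∈ rank< with p ← ∈-partitions⁻ σ∈
    with s′ , n≡ , q ← removeColumn-IsPartition (IsPartition-largestPart p) = π∈ , π-rank , back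
    where
    ℓ = length σ
    largestPart-σ≤ : largestPart σ ≤ suc (suc j + ℓ)
    largestPart-σ≤ = ≤-pred (subst (suc (largestPart σ) ≤_) (shift ℓ)
                       (≰⇒> (rank< ∘ Equivalence.from (RankAtLeast⇔ (j + 3) σ))))
      where
      shift : ∀ ℓ → j + 3 + ℓ ≡ 3 + (j + ℓ)
      shift ℓ = solve (j ∷ ℓ ∷ [])
    sizes : suc j + ℓ + s′ ≡ suc j + n
    sizes = trans (+-assoc (suc j) ℓ s′) (cong (suc j +_) (trans (+-comm ℓ s′) (sym n≡)))
    π∈ : columnToLargestPart j σ ∈ partitions (suc j + n)
    π∈ = ∈-partitions⁺ (subst (λ t → IsPartition (suc j + ℓ) t (columnToLargestPart j σ)) sizes
           (cons (s≤s z≤n) ≤-refl (IsPartition-mono (pred-mono-≤ largestPart-σ≤) q)))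
    π-rank : RankAtLeast j (columnToLargestPart j σ)
    π-rank = Equivalence.from (RankAtLeast⇔ j (columnToLargestPart j σ))
               (subst (_≤ suc j + ℓ) (sym (+-suc j _)) (s≤s (+-monoʳ-≤ j (length-removeColumn σ))))
    back : largestPartToColumn j (columnToLargestPart j σ) ≡ σ
    back = trans (cong (λ t → addColumn t (removeColumn σ)) (m+n∸m≡n (suc j) ℓ)) (addColumn-removeColumn p)

rankAtLeast-recurrence : ∀ j n → rankAtLeast j (suc j + n) + rankAtLeast (j + 3) n ≡ length (partitions n)
rankAtLeast-recurrence j n = trans
  (cong (_+ rankAtLeast (j + 3) n) (rankAtLeast-shift j n))
  (length-filter-∁+length-filter (rankAtLeast? (j + 3)) (partitions n))

rankAtLeast-vanishes : ∀ {j n} → n ≤ j → 0 < j + n → rankAtLeast j n ≡ 0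
rankAtLeast-vanishes {j} n≤j 0<j+n = length-filter-none (rankAtLeast? j) _ λ {π} π∈ rank≥ →
  <⇒≱ (+length≤largestPart⇒<size j (∈-partitions⁻ π∈) (Equivalence.to (RankAtLeast⇔ j π) rank≥) 0<j+n) n≤j

-- For j = n = 0 the two sides are 0 and 1: the empty partition has mex 1 and rank 0.
pbar≡rankAtLeast : ∀ n j → 0 < j + n → pbar 3 (suc j) n ≡ rankAtLeast j n
pbar≡rankAtLeast = <-rec (λ n → ∀ j → 0 < j + n → pbar 3 (suc j) n ≡ rankAtLeast j n) step
  where
  step : ∀ n → (∀ {n′} → n′ < n → ∀ j → 0 < j + n′ → pbar 3 (suc j) n′ ≡ rankAtLeast j n′) →
         ∀ j → 0 < j + n → pbar 3 (suc j) n ≡ rankAtLeast j n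
  step n ih j 0<j+n with n ≤? j
  ... | yes n≤j = trans (pbar-vanishes 3 (s≤s n≤j)) (sym (rankAtLeast-vanishes n≤j 0<j+n))
  ... | no  n≰j with n′ , refl ← m≤n⇒∃[o]m+o≡n (≰⇒> n≰j) = +-cancelʳ-≡ (pbar 3 (suc j + 3) n′) _ _ (begin
    pbar 3 (suc j) (suc j + n′) + pbar 3 (suc j + 3) n′   ≡⟨ pbar-recurrence 3 j n′ ⟩
    length (partitions n′)                                 ≡⟨ rankAtLeast-recurrence j n′ ⟨
    rankAtLeast j (suc j + n′) + rankAtLeast (j + 3) n′    ≡⟨ cong (rankAtLeast j (suc j + n′) +_) (ih (m<n+m n′ z<s) (j + 3) 0<j+3+n′) ⟨
    rankAtLeast j (suc j + n′) + pbar 3 (suc j + 3) n′     ∎)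
    where
    open ≡-Reasoning
    0<j+3+n′ : 0 < j + 3 + n′
    0<j+3+n′ = <-≤-trans z<s (≤-trans (m≤n+m 3 j) (m≤m+n (j + 3) n′))

theorem3p3 : (j n : ℕ) → 1 ≤ n → pbar 3 (suc j) n ≡ rankAtLeast j n
theorem3p3 j n 1≤n = pbar≡rankAtLeast n j (≤-trans 1≤n (m≤n+m n j))
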